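{- As formal power series, $$\sum_{i, j\geq 0}\frac{x^iy^{i+2j}q^{2i^2+4j^2+4ij-i}}{(q^2; q^2)_i(q^4; q^4)_j}=\sum_{i, j\geq 0}\frac{(-1)^j(x; q^2)_jy^{i+j}q^{i^2+j^2+2ij}}{(q^2; q^2)_i(q^2; q^2)_j}.$$
   Context: $(a;q)_n=(1-a)(1-aq)\cdots(1-aq^{n-1})$ for $n\ge1$, $(a;q)_0=1$. -}

module Defs where

open import Data.Nat as ℕ using (ℕ; zero; suc; _∸_; _≟_)
open import Data.Nat.Divisibility using (_∣?_)
open import Data.Integer as ℤ using (ℤ; +_; _+_; _*_; -_)
open import Data.Bool using (Bool; true; false; _∧_; if_then_else_)
open import Relation.Nullary using (does)

-- Formal power series in three commuting variables x, y, q with integer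
-- coefficients:  F a b c  is the coefficient of  x^a y^b q^c.
Series : Set
Series = ℕ → ℕ → ℕ → ℤ

sumTo : ℕ → (ℕ → ℤ) → ℤ
sumTo zero    f = f zero
sumTo (suc n) f = sumTo n f + f (suc n)

0S : Series
0S _ _ _ = + 0

mono : ℕ → ℕ → ℕ → Series
mono a b c a' b' c' =
  if does (a ≟ a') ∧ does (b ≟ b') ∧ does (c ≟ c') then + 1 else + 0

1S : Series
1S = mono 0 0 0

_⊕_ : Series → Series → Series
(f ⊕ g) a b c = f a b c + g a b c

_⊖_ : Series → Series → Series
(f ⊖ g) a b c = f a b c + (- g a b c)

_·_ : ℤ → Series → Series
(k · f) a b c = k * f a b c

_⊗_ : Series → Series → Series
(f ⊗ g) a b c =
  sumTo a λ a₁ → sumTo b λ b₁ → sumTo c λ c₁ →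
    f a₁ b₁ c₁ * g (a ∸ a₁) (b ∸ b₁) (c ∸ c₁)

infixl 6 _⊕_ _⊖_
infixl 7 _⊗_ _·_

neg1^ : ℕ → ℤ
neg1^ zero    = + 1
neg1^ (suc n) = - neg1^ n

-- geometric series 1/(1 - q^k) = Σ_{m ≥ 0} q^{k m}, for k ≥ 1
invOneMinusQ^ : (k : ℕ) → Series
invOneMinusQ^ k zero zero c = if does (k ∣? c) then + 1 else + 0
invOneMinusQ^ k _    _    _ = + 0

-- 1/(q^k; q^k)_n = Π_{m=1}^{n} 1/(1 - q^{k m})   (k ≥ 1)
invQPoch : (k n : ℕ) → Series
invQPoch k zero    = 1S
invQPoch k (suc n) = invQPoch k n ⊗ invOneMinusQ^ (k ℕ.* suc n)

xQPoch2 : ℕ → Series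
xQPoch2 zero    = 1S
xQPoch2 (suc n) = xQPoch2 n ⊗ (1S ⊖ mono 1 0 (2 ℕ.* n))

-- Double sum Σ_{i,j ≥ 0} T i j of a family in which every term T i j is
-- divisible by y^(i+j) (true of both families below).  Hence the coefficient
-- of x^a y^b q^c only receives contributions from i, j ≤ b, and the formal
-- (locally finite) infinite sum is computed by this finite sum.
Σ∞² : (ℕ → ℕ → Series) → Series
Σ∞² T a b c = sumTo b λ i → sumTo b λ j → T i j a b c

lhsTerm : ℕ → ℕ → Series
lhsTerm i j =
  mono i (i ℕ.+ 2 ℕ.* j)
       ((2 ℕ.* i ℕ.* i ∸ i) ℕ.+ 4 ℕ.* j ℕ.* j ℕ.+ 4 ℕ.* i ℕ.* j)
  ⊗ invQPoch 2 i ⊗ invQPoch 4 j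

rhsTerm : ℕ → ℕ → Series
rhsTerm i j =
  neg1^ j · (xQPoch2 j ⊗ mono 0 (i ℕ.+ j) (i ℕ.* i ℕ.+ j ℕ.* j ℕ.+ 2 ℕ.* i ℕ.* j))
  ⊗ invQPoch 2 i ⊗ invQPoch 2 j

module Submission where

open import Defs
open import Data.Nat using (ℕ)
open import Relation.Binary.PropositionalEquality using (_≡_)

open import Data.Nat as ℕ using (zero; suc; _∸_; _≟_)
import Data.Nat.Properties as ℕP
open import Data.Nat.Divisibility using (_∣?_; ∣-refl; _∣0; ∣m∣n⇒∣m+n; ∣m+n∣m⇒∣n; ∣⇒≤)
open import Data.Integer as ℤ using (ℤ; +_)
import Data.Integer.Properties as ℤP
open import Data.Bool using (true; false; if_then_else_)
open import Data.Maybe as Maybe using (Maybe)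
open import Data.Product using (_×_; _,_; proj₁)
open import Data.Sum using (inj₁; inj₂)
open import Data.Empty using (⊥-elim)
open import Function.Bundles using (mk⇔)
open import Relation.Nullary using (does; yes; no)
open import Relation.Nullary.Decidable using (dec-true; dec-false; does-⇔)
open import Relation.Binary.Consequences using (dec⇒weaklyDec)
open import Relation.Binary.PropositionalEquality as ≡ using (_≢_)
open import Algebra.Bundles using (CommutativeMonoid; CommutativeRing)
open import Algebra.Structures using (IsCommutativeRing)
open import Algebra.Solver.Ring.AlmostCommutativeRing using (_-Raw-AlmostCommutative⟶_; fromCommutativeRing)

-- The (i, j) term of the left side is homogeneous of degree i + 2j in y, that of the right
-- side of degree i + j.  With p = q², the y^n-parts of the two sides are y^n q^(n²) F n and
-- y^n q^(n²) G n, where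
--   F n = Σ_{i+2j=n} x^i q^(i²-i) / ((p;p)_i (p²;p²)_j),
--   G n = Σ_{i+j=n} (-1)^j (x;p)_j / ((p;p)_i (p;p)_j).
-- Splitting 1 - p^n termwise as (1 - p^(2j)) + p^(2j) (1 - p^i), resp. (1 - p^i) + p^i (1 - p^j),
-- the recurrences of the q-Pochhammer symbols show that both sequences satisfy
--   H 0 = 1,   (1 - p) H 1 = x,   (1 - p^(n+2)) H (n+2) = H n + x p^(n+1) H (n+1).
-- As 1 - p^k (k ≥ 1) is invertible in ℤ[[x,y,q]], this recurrence has only one solution.

module _ where
  open ≡.≡-Reasoning
  open import Data.Nat.Solver using (module +-*-Solver)
  open +-*-Solver using (solve; _:=_; _:+_; _:*_; con)

  i≤i*i : ∀ i → i ℕ.≤ i ℕ.* i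
  i≤i*i zero    = ℕ.z≤n
  i≤i*i (suc i) = ℕP.m≤m*n (suc i) (suc i)

  suc-square∸ : ∀ i → suc i ℕ.* suc i ∸ suc i ≡ 2 ℕ.* i ℕ.+ (i ℕ.* i ∸ i)
  suc-square∸ i = begin
    suc i ℕ.* suc i ∸ suc i  ≡⟨ ℕP.m+n∸m≡n (suc i) (i ℕ.* suc i) ⟩
    i ℕ.* suc i              ≡⟨ solve 1 (λ i → i :* (con 1 :+ i) := i :+ i :* i) ≡.refl i ⟩
    i ℕ.+ i ℕ.* i            ≡⟨ ≡.cong (i ℕ.+_) (ℕP.m+[n∸m]≡n (i≤i*i i)) ⟨
    i ℕ.+ (i ℕ.+ t)          ≡⟨ solve 2 (λ i t → i :+ (i :+ t) := con 2 :* i :+ t) ≡.refl i t ⟩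
    2 ℕ.* i ℕ.+ t            ∎
    where t = i ℕ.* i ∸ i

  lhs-exponent : ∀ i j → (i ℕ.+ 2 ℕ.* j) ℕ.* (i ℕ.+ 2 ℕ.* j) ℕ.+ (i ℕ.* i ∸ i)
                       ≡ (2 ℕ.* i ℕ.* i ∸ i) ℕ.+ 4 ℕ.* j ℕ.* j ℕ.+ 4 ℕ.* i ℕ.* j
  lhs-exponent i j = begin
    (i ℕ.+ 2 ℕ.* j) ℕ.* (i ℕ.+ 2 ℕ.* j) ℕ.+ t
      ≡⟨ solve 3 (λ i j t → (i :+ con 2 :* j) :* (i :+ con 2 :* j) :+ t
                          := (i :* i :+ t) :+ con 4 :* j :* j :+ con 4 :* i :* j) ≡.refl i j t ⟩
    (i ℕ.* i ℕ.+ t) ℕ.+ 4 ℕ.* j ℕ.* j ℕ.+ 4 ℕ.* i ℕ.* j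
      ≡⟨ ≡.cong (λ k → k ℕ.+ 4 ℕ.* j ℕ.* j ℕ.+ 4 ℕ.* i ℕ.* j) (ℕP.+-∸-assoc (i ℕ.* i) (i≤i*i i)) ⟨
    (i ℕ.* i ℕ.+ i ℕ.* i ∸ i) ℕ.+ 4 ℕ.* j ℕ.* j ℕ.+ 4 ℕ.* i ℕ.* j
      ≡⟨ ≡.cong (λ k → (k ∸ i) ℕ.+ 4 ℕ.* j ℕ.* j ℕ.+ 4 ℕ.* i ℕ.* j)
                (solve 1 (λ i → i :* i :+ i :* i := con 2 :* i :* i) ≡.refl i) ⟩
    (2 ℕ.* i ℕ.* i ∸ i) ℕ.+ 4 ℕ.* j ℕ.* j ℕ.+ 4 ℕ.* i ℕ.* j ∎
    where t = i ℕ.* i ∸ i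

  rhs-exponent : ∀ i j → i ℕ.* i ℕ.+ j ℕ.* j ℕ.+ 2 ℕ.* i ℕ.* j ≡ (i ℕ.+ j) ℕ.* (i ℕ.+ j)
  rhs-exponent = solve 2 (λ i j → i :* i :+ j :* j :+ con 2 :* i :* j := (i :+ j) :* (i :+ j)) ≡.refl

  +-2*-suc : ∀ i j → i ℕ.+ 2 ℕ.* suc j ≡ suc (suc (i ℕ.+ 2 ℕ.* j))
  +-2*-suc = solve 2 (λ i j → i :+ con 2 :* (con 1 :+ j) := con 2 :+ (i :+ con 2 :* j)) ≡.refl

antidiagonal : ∀ {a} {A : Set a} → (A → A → A) → ℕ → (ℕ → ℕ → A) → A
antidiagonal _+_ zero    g = g 0 0
antidiagonal _+_ (suc n) g = g 0 (suc n) + antidiagonal _+_ n (λ i j → g (suc i) j)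

antidiagonal₂ : ∀ {a} {A : Set a} → (A → A → A) → ℕ → (ℕ → ℕ → A) → A
antidiagonal₂ _+_ zero          g = g 0 0
antidiagonal₂ _+_ (suc zero)    g = g 1 0
antidiagonal₂ _+_ (suc (suc n)) g = g (suc (suc n)) 0 + antidiagonal₂ _+_ n (λ i j → g i (suc j))

antidiagonal-pointwise : ∀ {a b} {A : Set a} {X : Set b} (_+_ : A → A → A) n (G : ℕ → ℕ → X → A) x →
  antidiagonal (λ f g x → f x + g x) n G x ≡ antidiagonal _+_ n (λ i j → G i j x)
antidiagonal-pointwise _+_ zero    G x = ≡.refl
antidiagonal-pointwise _+_ (suc n) G x =
  ≡.cong (λ s → G 0 (suc n) x + s) (antidiagonal-pointwise _+_ n (λ i j → G (suc i) j) x)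

antidiagonal₂-pointwise : ∀ {a b} {A : Set a} {X : Set b} (_+_ : A → A → A) n (G : ℕ → ℕ → X → A) x →
  antidiagonal₂ (λ f g x → f x + g x) n G x ≡ antidiagonal₂ _+_ n (λ i j → G i j x)
antidiagonal₂-pointwise _+_ zero          G x = ≡.refl
antidiagonal₂-pointwise _+_ (suc zero)    G x = ≡.refl
antidiagonal₂-pointwise _+_ (suc (suc n)) G x =
  ≡.cong (λ s → G (suc (suc n)) 0 x + s) (antidiagonal₂-pointwise _+_ n (λ i j → G i (suc j)) x)

module AntidiagonalSums {c ℓ} (M : CommutativeMonoid c ℓ) where

  open CommutativeMonoid M
  open import Algebra.Properties.CommutativeSemigroup commutativeSemigroup using (interchange)
  open import Relation.Binary.Reasoning.Setoid setoid

  ∑ ∑₂ : ℕ → (ℕ → ℕ → Carrier) → Carrier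
  ∑  = antidiagonal _∙_
  ∑₂ = antidiagonal₂ _∙_

  ∑-cong-on : ∀ n {g h} → (∀ i j → i ℕ.+ j ≡ n → g i j ≈ h i j) → ∑ n g ≈ ∑ n h
  ∑-cong-on zero    g≈h = g≈h 0 0 ≡.refl
  ∑-cong-on (suc n) g≈h =
    ∙-cong (g≈h 0 (suc n) ≡.refl) (∑-cong-on n (λ i j i+j≡n → g≈h (suc i) j (≡.cong suc i+j≡n)))

  ∑-cong : ∀ n {g h} → (∀ i j → g i j ≈ h i j) → ∑ n g ≈ ∑ n h
  ∑-cong n g≈h = ∑-cong-on n (λ i j _ → g≈h i j)

  ∑-distrib-∙ : ∀ n g h → ∑ n (λ i j → g i j ∙ h i j) ≈ ∑ n g ∙ ∑ n h
  ∑-distrib-∙ zero    g h = refl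
  ∑-distrib-∙ (suc n) g h = trans (∙-congˡ (∑-distrib-∙ n _ _)) (interchange _ _ _ _)

  ∑-ε : ∀ n → ∑ n (λ _ _ → ε) ≈ ε
  ∑-ε zero    = refl
  ∑-ε (suc n) = trans (∙-congˡ (∑-ε n)) (identityʳ ε)

  ∑-snoc : ∀ n g → ∑ (suc n) g ≈ ∑ n (λ i j → g i (suc j)) ∙ g (suc n) 0
  ∑-snoc zero    g = refl
  ∑-snoc (suc n) g = begin
    g 0 (suc (suc n)) ∙ ∑ (suc n) (λ i j → g (suc i) j)
      ≈⟨ ∙-congˡ (∑-snoc n (λ i j → g (suc i) j)) ⟩
    g 0 (suc (suc n)) ∙ (∑ n (λ i j → g (suc i) (suc j)) ∙ g (suc (suc n)) 0)
      ≈⟨ assoc _ _ _ ⟨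
    g 0 (suc (suc n)) ∙ ∑ n (λ i j → g (suc i) (suc j)) ∙ g (suc (suc n)) 0
      ∎

  ∑-swap : ∀ n g → ∑ n g ≈ ∑ n (λ i j → g j i)
  ∑-swap zero    g = refl
  ∑-swap (suc n) g = begin
    g 0 (suc n) ∙ ∑ n (λ i j → g (suc i) j)  ≈⟨ comm _ _ ⟩
    ∑ n (λ i j → g (suc i) j) ∙ g 0 (suc n)  ≈⟨ ∙-congʳ (∑-swap n _) ⟩
    ∑ n (λ i j → g (suc j) i) ∙ g 0 (suc n)  ≈⟨ ∑-snoc n (λ i j → g j i) ⟨
    ∑ (suc n) (λ i j → g j i)                ∎

  -- Both sides are the sum of H i j l over i + j + l = n.
  ∑-assoc : ∀ n (H : ℕ → ℕ → ℕ → Carrier) →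
    ∑ n (λ m l → ∑ m (λ i j → H i j l)) ≈ ∑ n (λ i m → ∑ m (λ j l → H i j l))
  ∑-assoc zero    H = refl
  ∑-assoc (suc n) H = begin
    H 0 0 (suc n) ∙ ∑ n (λ m l → H 0 (suc m) l ∙ ∑ m (λ i j → H (suc i) j l))
      ≈⟨ ∙-congˡ (∑-distrib-∙ n _ _) ⟩
    H 0 0 (suc n) ∙ (∑ n (λ m l → H 0 (suc m) l) ∙ ∑ n (λ m l → ∑ m (λ i j → H (suc i) j l)))
      ≈⟨ assoc _ _ _ ⟨
    H 0 0 (suc n) ∙ ∑ n (λ m l → H 0 (suc m) l) ∙ ∑ n (λ m l → ∑ m (λ i j → H (suc i) j l))
      ≈⟨ ∙-congˡ (∑-assoc n (λ i → H (suc i))) ⟩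
    H 0 0 (suc n) ∙ ∑ n (λ m l → H 0 (suc m) l) ∙ ∑ n (λ i m → ∑ m (λ j l → H (suc i) j l))
      ∎

  ∑₂-cong-on : ∀ n {g h} → (∀ i j → i ℕ.+ 2 ℕ.* j ≡ n → g i j ≈ h i j) → ∑₂ n g ≈ ∑₂ n h
  ∑₂-cong-on zero          g≈h = g≈h 0 0 ≡.refl
  ∑₂-cong-on (suc zero)    g≈h = g≈h 1 0 ≡.refl
  ∑₂-cong-on (suc (suc n)) g≈h =
    ∙-cong (g≈h (suc (suc n)) 0 (≡.cong (λ m → suc (suc m)) (ℕP.+-identityʳ n)))
           (∑₂-cong-on n (λ i j i+2j≡n → g≈h i (suc j) (≡.trans (+-2*-suc i j) (≡.cong (λ m → suc (suc m)) i+2j≡n))))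

  ∑₂-cong : ∀ n {g h} → (∀ i j → g i j ≈ h i j) → ∑₂ n g ≈ ∑₂ n h
  ∑₂-cong n g≈h = ∑₂-cong-on n (λ i j _ → g≈h i j)

  ∑₂-distrib-∙ : ∀ n g h → ∑₂ n (λ i j → g i j ∙ h i j) ≈ ∑₂ n g ∙ ∑₂ n h
  ∑₂-distrib-∙ zero          g h = refl
  ∑₂-distrib-∙ (suc zero)    g h = refl
  ∑₂-distrib-∙ (suc (suc n)) g h = trans (∙-congˡ (∑₂-distrib-∙ n _ _)) (interchange _ _ _ _)

  ∑₂-suc : ∀ n g → (∀ j → g 0 j ≈ ε) → ∑₂ (suc n) g ≈ ∑₂ n (λ i j → g (suc i) j)
  ∑₂-suc zero          g g0≈ε = refl
  ∑₂-suc (suc zero)    g g0≈ε = trans (∙-congˡ (g0≈ε 1)) (identityʳ _)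
  ∑₂-suc (suc (suc n)) g g0≈ε = ∙-congˡ (∑₂-suc n (λ i j → g i (suc j)) (λ j → g0≈ε (suc j)))

module AntidiagonalSumsInRing {c ℓ} (R : CommutativeRing c ℓ) where

  open CommutativeRing R
  open AntidiagonalSums +-commutativeMonoid public

  ∑-distribˡ : ∀ n x g → x * ∑ n g ≈ ∑ n (λ i j → x * g i j)
  ∑-distribˡ zero    x g = refl
  ∑-distribˡ (suc n) x g = trans (distribˡ x _ _) (+-congˡ (∑-distribˡ n x _))

  ∑-distribʳ : ∀ n x g → ∑ n g * x ≈ ∑ n (λ i j → g i j * x)
  ∑-distribʳ n x g = trans (*-comm _ _) (trans (∑-distribˡ n x g) (∑-cong n (λ i j → *-comm _ _)))

  ∑₂-distribˡ : ∀ n x g → x * ∑₂ n g ≈ ∑₂ n (λ i j → x * g i j)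
  ∑₂-distribˡ zero          x g = refl
  ∑₂-distribˡ (suc zero)    x g = refl
  ∑₂-distribˡ (suc (suc n)) x g = trans (distribˡ x _ _) (+-congˡ (∑₂-distribˡ n x _))

  ∑-neg : ∀ n g → - ∑ n g ≈ ∑ n (λ i j → - g i j)
  ∑-neg zero    g = refl
  ∑-neg (suc n) g = trans (sym (-‿+-comm _ _)) (+-congˡ (∑-neg n _))
    where open import Algebra.Properties.Ring ring using (-‿+-comm)

-- Formal power series in one variable

module PowerSeries {c ℓ} (R : CommutativeRing c ℓ) where

  open CommutativeRing R
  open AntidiagonalSumsInRing R
  open import Algebra.Properties.Ring ring using (-0#≈0#)
  open import Relation.Binary.Reasoning.Setoid setoid

  PS : Set c
  PS = ℕ → Carrier

  infix 4 _≋_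
  record _≋_ (f g : PS) : Set ℓ where
    constructor coeffwise
    field coeff : ∀ n → f n ≈ g n
  open _≋_ public

  infixl 6 _⊞_
  infixl 7 _⊠_
  infix  8 ⊟_

  _⊞_ _⊠_ : PS → PS → PS
  (f ⊞ g) n = f n + g n
  (f ⊠ g) n = ∑ n (λ i j → f i * g j)

  ⊟_ : PS → PS
  (⊟ f) n = - f n

  0ₚ : PS
  0ₚ _ = 0#

  -- r t^k.  Since ℕ's _≟_ computes through _≡ᵇ_, monomial (suc k) r (suc n) reduces to
  -- monomial k r n.
  monomial : ℕ → Carrier → PS
  monomial k r n = if does (k ≟ n) then r else 0#

  C : Carrier → PS
  C = monomial 0

  ⊠-comm : ∀ f g → f ⊠ g ≋ g ⊠ f
  ⊠-comm f g = coeffwise λ n → trans (∑-swap n _) (∑-cong n (λ i j → *-comm _ _))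

  ⊠-assoc : ∀ f g h → (f ⊠ g) ⊠ h ≋ f ⊠ (g ⊠ h)
  ⊠-assoc f g h = coeffwise λ n → begin
    ∑ n (λ m l → ∑ m (λ i j → f i * g j) * h l)     ≈⟨ ∑-cong n (λ m l → ∑-distribʳ m (h l) _) ⟩
    ∑ n (λ m l → ∑ m (λ i j → f i * g j * h l))     ≈⟨ ∑-assoc n (λ i j l → f i * g j * h l) ⟩
    ∑ n (λ i m → ∑ m (λ j l → f i * g j * h l))     ≈⟨ ∑-cong n (λ i m → ∑-cong m (λ j l → *-assoc _ _ _)) ⟩
    ∑ n (λ i m → ∑ m (λ j l → f i * (g j * h l)))   ≈⟨ ∑-cong n (λ i m → ∑-distribˡ m (f i) _) ⟨
    ∑ n (λ i m → f i * ∑ m (λ j l → g j * h l))     ∎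

  C-⊠ : ∀ r f → (C r ⊠ f) ≋ (λ n → r * f n)
  C-⊠ r f = coeffwise λ
    { zero    → refl
    ; (suc n) → begin
        r * f (suc n) + ∑ n (λ i j → 0# * f j)  ≈⟨ +-congˡ (trans (∑-cong n (λ i j → zeroˡ _)) (∑-ε n)) ⟩
        r * f (suc n) + 0#                     ≈⟨ +-identityʳ _ ⟩
        r * f (suc n)                          ∎ }

  ⊠-distribˡ : ∀ f g h → f ⊠ (g ⊞ h) ≋ (f ⊠ g) ⊞ (f ⊠ h)
  ⊠-distribˡ f g h = coeffwise λ n → trans (∑-cong n (λ i j → distribˡ _ _ _)) (∑-distrib-∙ n _ _)

  ⊠-cong : ∀ {f f′ g g′} → f ≋ f′ → g ≋ g′ → f ⊠ g ≋ f′ ⊠ g′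
  ⊠-cong f≋f′ g≋g′ = coeffwise λ n → ∑-cong n (λ i j → *-cong (coeff f≋f′ i) (coeff g≋g′ j))

  ≋-trans : ∀ {f g h} → f ≋ g → g ≋ h → f ≋ h
  ≋-trans f≋g g≋h = coeffwise λ n → trans (coeff f≋g n) (coeff g≋h n)

  ⊞-⊠-isCommutativeRing : IsCommutativeRing _≋_ _⊞_ _⊠_ ⊟_ 0ₚ (C 1#)
  ⊞-⊠-isCommutativeRing = record
    { isRing = record
      { +-isAbelianGroup = record
        { isGroup = record
          { isMonoid = record
            { isSemigroup = record
              { isMagma = record
                { isEquivalence = record
                  { refl  = coeffwise λ _ → refl
                  ; sym   = λ f≋g → coeffwise λ n → sym (coeff f≋g n)
                  ; trans = ≋-trans
                  }
                ; ∙-cong = λ f≋f′ g≋g′ → coeffwise λ n → +-cong (coeff f≋f′ n) (coeff g≋g′ n)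
                }
              ; assoc = λ _ _ _ → coeffwise λ _ → +-assoc _ _ _
              }
            ; identity = (λ _ → coeffwise λ _ → +-identityˡ _) , (λ _ → coeffwise λ _ → +-identityʳ _)
            }
          ; inverse = (λ _ → coeffwise λ _ → -‿inverseˡ _) , (λ _ → coeffwise λ _ → -‿inverseʳ _)
          ; ⁻¹-cong = λ f≋g → coeffwise λ n → -‿cong (coeff f≋g n)
          }
        ; comm = λ _ _ → coeffwise λ _ → +-comm _ _
        }
      ; *-cong     = ⊠-cong
      ; *-assoc    = ⊠-assoc
      ; *-identity = (λ f → C-⊠-identity f) , (λ f → ≋-trans (⊠-comm f (C 1#)) (C-⊠-identity f))
      ; distrib    = ⊠-distribˡ , λ f g h → ≋-trans (⊠-comm (g ⊞ h) f) (≋-trans (⊠-distribˡ f g h)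
                       (coeffwise λ n → +-cong (coeff (⊠-comm f g) n) (coeff (⊠-comm f h) n)))
      }
    ; *-comm = ⊠-comm
    }
    where
    C-⊠-identity : ∀ f → C 1# ⊠ f ≋ f
    C-⊠-identity f = ≋-trans (C-⊠ 1# f) (coeffwise λ n → *-identityˡ _)

  ⊞-⊠-commutativeRing : CommutativeRing c ℓ
  ⊞-⊠-commutativeRing = record { isCommutativeRing = ⊞-⊠-isCommutativeRing }

  monomial-cong : ∀ k {r s} → r ≈ s → monomial k r ≋ monomial k s
  monomial-cong k r≈s = coeffwise λ n → go n
    where
    go : ∀ n → monomial k _ n ≈ monomial k _ n
    go n with does (k ≟ n)
    ... | true  = r≈s
    ... | false = refl

  C-cong : ∀ {r s} → r ≈ s → C r ≋ C s
  C-cong = monomial-cong 0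

  C-+ : ∀ r s → C (r + s) ≋ C r ⊞ C s
  C-+ r s = coeffwise λ { zero → refl ; (suc n) → sym (+-identityʳ 0#) }

  C-* : ∀ r s → C (r * s) ≋ C r ⊠ C s
  C-* r s = coeffwise λ n → trans (C-*-coeff n) (sym (coeff (C-⊠ r (C s)) n))
    where
    C-*-coeff : ∀ n → C (r * s) n ≈ r * C s n
    C-*-coeff zero    = refl
    C-*-coeff (suc n) = sym (zeroʳ r)

  C-neg : ∀ r → C (- r) ≋ ⊟ C r
  C-neg r = coeffwise λ { zero → refl ; (suc n) → sym -0#≈0# }

  C-0 : C 0# ≋ 0ₚ
  C-0 = coeffwise λ { zero → refl ; (suc n) → refl }

  monomial-⊠-zero : ∀ k r f → (monomial (suc k) r ⊠ f) 0 ≈ 0#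
  monomial-⊠-zero k r f = zeroˡ (f 0)

  monomial-⊠-suc : ∀ k r f n → (monomial (suc k) r ⊠ f) (suc n) ≈ (monomial k r ⊠ f) n
  monomial-⊠-suc k r f n = trans (+-congʳ (zeroˡ _)) (+-identityˡ _)

  monomial-⊠-+ : ∀ k r f n → (monomial k r ⊠ f) (k ℕ.+ n) ≈ r * f n
  monomial-⊠-+ zero    r f n = coeff (C-⊠ r f) n
  monomial-⊠-+ (suc k) r f n = trans (monomial-⊠-suc k r f (k ℕ.+ n)) (monomial-⊠-+ k r f n)

  monomial-⊠-< : ∀ k r f n → n ℕ.< k → (monomial k r ⊠ f) n ≈ 0#
  monomial-⊠-< (suc k) r f zero    _             = monomial-⊠-zero k r f
  monomial-⊠-< (suc k) r f (suc n) (ℕ.s≤s n<k) = trans (monomial-⊠-suc k r f n) (monomial-⊠-< k r f n n<k)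

  monomial-⊠-monomial : ∀ k k′ r r′ → monomial k r ⊠ monomial k′ r′ ≋ monomial (k ℕ.+ k′) (r * r′)
  monomial-⊠-monomial k k′ r r′ = coeffwise (go k)
    where
    *-monomial : ∀ n → r * monomial k′ r′ n ≈ monomial k′ (r * r′) n
    *-monomial n with does (k′ ≟ n)
    ... | true  = refl
    ... | false = zeroʳ r
    go : ∀ k n → (monomial k r ⊠ monomial k′ r′) n ≈ monomial (k ℕ.+ k′) (r * r′) n
    go zero    n = trans (coeff (C-⊠ r (monomial k′ r′)) n) (*-monomial n)
    go (suc k) zero    = monomial-⊠-zero k r (monomial k′ r′)
    go (suc k) (suc n) = trans (monomial-⊠-suc k r (monomial k′ r′) n) (go k n)

  geometric : ℕ → PS
  geometric k n = if does (k ∣? n) then 1# else 0#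

  geometric-inverse : ∀ k → geometric (suc k) ⊠ (C 1# ⊞ ⊟ monomial (suc k) 1#) ≋ C 1#
  geometric-inverse k = ≋-trans expand (coeffwise telescope)
    where
    K = suc k
    g = geometric K
    t^K = monomial K 1#
    module P = CommutativeRing ⊞-⊠-commutativeRing
    open import Algebra.Properties.Ring P.ring using (-‿distribʳ-*)

    expand : g ⊠ (C 1# ⊞ ⊟ t^K) ≋ g ⊞ ⊟ (t^K ⊠ g)
    expand = P.trans (P.distribˡ g _ _)
      (P.+-cong (P.*-identityʳ g) (P.trans (P.sym (-‿distribʳ-* g t^K)) (P.-‿cong (P.*-comm g t^K))))

    g-periodic : ∀ m → g (K ℕ.+ m) ≡ g m
    g-periodic m = ≡.cong (λ b → if b then 1# else 0#)
      (does-⇔ (mk⇔ (λ K∣K+m → ∣m+n∣m⇒∣n K∣K+m ∣-refl) (∣m∣n⇒∣m+n ∣-refl)) (K ∣? (K ℕ.+ m)) (K ∣? m))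

    g-below : ∀ n → n ℕ.< K → g n ≡ C 1# n
    g-below zero    _   = ≡.cong (λ b → if b then 1# else 0#) (dec-true (K ∣? 0) (K ∣0))
    g-below (suc n) n<K = ≡.cong (λ b → if b then 1# else 0#) (dec-false (K ∣? suc n) (λ K∣n → ℕP.<⇒≱ n<K (∣⇒≤ K∣n)))

    telescope : ∀ n → g n + - (t^K ⊠ g) n ≈ C 1# n
    telescope n with ℕP.≤-<-connex K n
    ... | inj₂ n<K = begin
      g n + - (t^K ⊠ g) n  ≈⟨ +-congˡ (-‿cong (monomial-⊠-< K 1# g n n<K)) ⟩
      g n + - 0#           ≈⟨ +-congˡ -0#≈0# ⟩
      g n + 0#             ≈⟨ +-identityʳ (g n) ⟩
      g n                  ≡⟨ g-below n n<K ⟩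
      C 1# n               ∎
    ... | inj₁ K≤n = ≡.subst (λ n → g n + - (t^K ⊠ g) n ≈ C 1# n) (ℕP.m+[n∸m]≡n K≤n) (begin
      g (K ℕ.+ m) + - (t^K ⊠ g) (K ℕ.+ m)  ≈⟨ +-congˡ (-‿cong (monomial-⊠-+ K 1# g m)) ⟩
      g (K ℕ.+ m) + - (1# * g m)           ≡⟨ ≡.cong (λ x → x + - (1# * g m)) (g-periodic m) ⟩
      g m + - (1# * g m)                   ≈⟨ +-congˡ (-‿cong (*-identityˡ (g m))) ⟩
      g m + - g m                          ≈⟨ -‿inverseʳ (g m) ⟩
      0#                                   ∎)
      where m = n ℕ.∸ K

module ℤ-Sums = AntidiagonalSums ℤP.+-0-commutativeMonoid

module _ where
  open ≡.≡-Reasoning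

  sumTo-cong-on : ∀ n {f g : ℕ → ℤ} → (∀ k → k ℕ.≤ n → f k ≡ g k) → sumTo n f ≡ sumTo n g
  sumTo-cong-on zero    f≡g = f≡g 0 ℕ.z≤n
  sumTo-cong-on (suc n) f≡g =
    ≡.cong₂ ℤ._+_ (sumTo-cong-on n (λ k k≤n → f≡g k (ℕP.m≤n⇒m≤1+n k≤n))) (f≡g (suc n) ℕP.≤-refl)

  sumTo-cong : ∀ n {f g : ℕ → ℤ} → (∀ k → f k ≡ g k) → sumTo n f ≡ sumTo n g
  sumTo-cong n f≡g = sumTo-cong-on n (λ k _ → f≡g k)

  sumTo-antidiagonal : ∀ n (h : ℕ → ℕ → ℤ) → sumTo n (λ k → h k (n ∸ k)) ≡ antidiagonal ℤ._+_ n h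
  sumTo-antidiagonal zero    h = ≡.refl
  sumTo-antidiagonal (suc n) h = begin
    sumTo n (λ k → h k (suc n ∸ k)) ℤ.+ h (suc n) (n ∸ n)
      ≡⟨ ≡.cong₂ ℤ._+_ (sumTo-cong-on n (λ k k≤n → ≡.cong (h k) (ℕP.+-∸-assoc 1 k≤n)))
                       (≡.cong (h (suc n)) (ℕP.n∸n≡0 n)) ⟩
    sumTo n (λ k → h k (suc (n ∸ k))) ℤ.+ h (suc n) 0
      ≡⟨ ≡.cong (ℤ._+ h (suc n) 0) (sumTo-antidiagonal n (λ i j → h i (suc j))) ⟩
    antidiagonal ℤ._+_ n (λ i j → h i (suc j)) ℤ.+ h (suc n) 0
      ≡⟨ ℤ-Sums.∑-snoc n h ⟨
    antidiagonal ℤ._+_ (suc n) h ∎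

  sumTo-zero : ∀ n (f : ℕ → ℤ) → (∀ k → f k ≡ + 0) → sumTo n f ≡ + 0
  sumTo-zero zero    f f≡0 = f≡0 0
  sumTo-zero (suc n) f f≡0 = ≡.cong₂ ℤ._+_ (sumTo-zero n f f≡0) (f≡0 (suc n))

  sumTo-distrib-+ : ∀ n (f g : ℕ → ℤ) → sumTo n (λ k → f k ℤ.+ g k) ≡ sumTo n f ℤ.+ sumTo n g
  sumTo-distrib-+ zero    f g = ≡.refl
  sumTo-distrib-+ (suc n) f g =
    ≡.trans (≡.cong (ℤ._+ (f (suc n) ℤ.+ g (suc n))) (sumTo-distrib-+ n f g))
            (interchange (sumTo n f) (sumTo n g) (f (suc n)) (g (suc n)))
    where open import Algebra.Properties.CommutativeSemigroup ℤP.+-commutativeSemigroup using (interchange)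

  sumTo-peelˡ : ∀ n (f : ℕ → ℤ) → sumTo (suc n) f ≡ f 0 ℤ.+ sumTo n (λ k → f (suc k))
  sumTo-peelˡ zero    f = ≡.refl
  sumTo-peelˡ (suc n) f = ≡.trans (≡.cong (ℤ._+ f (suc (suc n))) (sumTo-peelˡ n f)) (ℤP.+-assoc (f 0) _ _)

  sumTo-single : ∀ N m (f : ℕ → ℤ) → m ℕ.≤ N → (∀ k → k ≢ m → f k ≡ + 0) → sumTo N f ≡ f m
  sumTo-single zero    zero    f _          _    = ≡.refl
  sumTo-single (suc N) zero    f _          f≡0 = begin
    sumTo (suc N) f                      ≡⟨ sumTo-peelˡ N f ⟩
    f 0 ℤ.+ sumTo N (λ k → f (suc k))    ≡⟨ ≡.cong (λ s → f 0 ℤ.+ s) (sumTo-zero N _ (λ k → f≡0 (suc k) (λ ()))) ⟩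
    f 0 ℤ.+ + 0                          ≡⟨ ℤP.+-identityʳ (f 0) ⟩
    f 0                                  ∎
  sumTo-single (suc N) (suc m) f (ℕ.s≤s m≤N) f≡0 = begin
    sumTo (suc N) f                      ≡⟨ sumTo-peelˡ N f ⟩
    f 0 ℤ.+ sumTo N (λ k → f (suc k))    ≡⟨ ≡.cong₂ ℤ._+_ (f≡0 0 (λ ()))
                                              (sumTo-single N m (λ k → f (suc k)) m≤N
                                                 (λ k k≢m → f≡0 (suc k) (λ { ≡.refl → k≢m ≡.refl }))) ⟩
    + 0 ℤ.+ f (suc m)                    ≡⟨ ℤP.+-identityˡ (f (suc m)) ⟩
    f (suc m)                            ∎

  sumTo-sumTo-peel : ∀ N₁ N₂ (g : ℕ → ℕ → ℤ) →
    sumTo N₁ (λ i → sumTo (suc N₂) (g i)) ≡ sumTo N₁ (λ i → g i 0) ℤ.+ sumTo N₁ (λ i → sumTo N₂ (λ j → g i (suc j)))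
  sumTo-sumTo-peel N₁ N₂ g = ≡.trans (sumTo-cong N₁ (λ i → sumTo-peelˡ N₂ (g i))) (sumTo-distrib-+ N₁ _ _)

  sumTo-sumTo-column : ∀ N₁ N₂ (g : ℕ → ℕ → ℤ) → (∀ i j → g i (suc j) ≡ + 0) →
    sumTo N₁ (λ i → sumTo N₂ (g i)) ≡ sumTo N₁ (λ i → g i 0)
  sumTo-sumTo-column N₁ zero    g _   = ≡.refl
  sumTo-sumTo-column N₁ (suc N₂) g g≡0 = begin
    sumTo N₁ (λ i → sumTo (suc N₂) (g i))
      ≡⟨ sumTo-sumTo-peel N₁ N₂ g ⟩
    sumTo N₁ (λ i → g i 0) ℤ.+ sumTo N₁ (λ i → sumTo N₂ (λ j → g i (suc j)))
      ≡⟨ ≡.cong (λ s → sumTo N₁ (λ i → g i 0) ℤ.+ s) (sumTo-zero N₁ _ (λ i → sumTo-zero N₂ _ (g≡0 i))) ⟩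
    sumTo N₁ (λ i → g i 0) ℤ.+ + 0
      ≡⟨ ℤP.+-identityʳ _ ⟩
    sumTo N₁ (λ i → g i 0) ∎

  i+0≢n : ∀ {i n} → i ≢ n → i ℕ.+ 0 ≢ n
  i+0≢n {i} i≢n i+0≡n = i≢n (≡.trans (≡.sym (ℕP.+-identityʳ i)) i+0≡n)

  sumTo-sumTo-antidiagonal : ∀ n N₁ N₂ (g : ℕ → ℕ → ℤ) → n ℕ.≤ N₁ → n ℕ.≤ N₂ →
    (∀ i j → i ℕ.+ j ≢ n → g i j ≡ + 0) → sumTo N₁ (λ i → sumTo N₂ (g i)) ≡ antidiagonal ℤ._+_ n g
  sumTo-sumTo-antidiagonal zero N₁ N₂ g _ _ g≡0 =
    ≡.trans (sumTo-sumTo-column N₁ N₂ g (λ i j → g≡0 i (suc j) (λ e → ℕP.1+n≢0 (≡.trans (≡.sym (ℕP.+-suc i j)) e))))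
            (sumTo-single N₁ 0 (λ i → g i 0) ℕ.z≤n (λ i i≢0 → g≡0 i 0 (i+0≢n i≢0)))
  sumTo-sumTo-antidiagonal (suc n) N₁ (suc N₂) g 1+n≤N₁ (ℕ.s≤s n≤N₂) g≡0 = begin
    sumTo N₁ (λ i → sumTo (suc N₂) (g i))
      ≡⟨ sumTo-sumTo-peel N₁ N₂ g ⟩
    sumTo N₁ (λ i → g i 0) ℤ.+ sumTo N₁ (λ i → sumTo N₂ (λ j → g i (suc j)))
      ≡⟨ ≡.cong₂ ℤ._+_ (sumTo-single N₁ (suc n) (λ i → g i 0) 1+n≤N₁ (λ i i≢1+n → g≡0 i 0 (i+0≢n i≢1+n)))
                       (sumTo-sumTo-antidiagonal n N₁ N₂ (λ i j → g i (suc j)) (ℕP.<⇒≤ 1+n≤N₁) n≤N₂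
                          (λ i j i+j≢n → g≡0 i (suc j)
                             (λ e → i+j≢n (ℕP.suc-injective (≡.trans (≡.sym (ℕP.+-suc i j)) e))))) ⟩
    g (suc n) 0 ℤ.+ antidiagonal ℤ._+_ n (λ i j → g i (suc j))
      ≡⟨ ℤP.+-comm (g (suc n) 0) _ ⟩
    antidiagonal ℤ._+_ n (λ i j → g i (suc j)) ℤ.+ g (suc n) 0
      ≡⟨ ℤ-Sums.∑-snoc n g ⟨
    antidiagonal ℤ._+_ (suc n) g ∎

  sumTo-sumTo-antidiagonal₂ : ∀ n N₁ N₂ (g : ℕ → ℕ → ℤ) → n ℕ.≤ N₁ → n ℕ.≤ N₂ →
    (∀ i j → i ℕ.+ 2 ℕ.* j ≢ n → g i j ≡ + 0) → sumTo N₁ (λ i → sumTo N₂ (g i)) ≡ antidiagonal₂ ℤ._+_ n g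
  sumTo-sumTo-antidiagonal₂ zero N₁ N₂ g _ _ g≡0 =
    ≡.trans (sumTo-sumTo-column N₁ N₂ g (λ i j → g≡0 i (suc j) (λ e → ℕP.1+n≢0 (≡.trans (≡.sym (+-2*-suc i j)) e))))
            (sumTo-single N₁ 0 (λ i → g i 0) ℕ.z≤n (λ i i≢0 → g≡0 i 0 (i+0≢n i≢0)))
  sumTo-sumTo-antidiagonal₂ (suc zero) N₁ N₂ g 1≤N₁ _ g≡0 =
    ≡.trans (sumTo-sumTo-column N₁ N₂ g
               (λ i j → g≡0 i (suc j) (λ e → ℕP.1+n≢0 (ℕP.suc-injective (≡.trans (≡.sym (+-2*-suc i j)) e)))))
            (sumTo-single N₁ 1 (λ i → g i 0) 1≤N₁ (λ i i≢1 → g≡0 i 0 (i+0≢n i≢1)))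
  sumTo-sumTo-antidiagonal₂ (suc (suc n)) N₁ (suc N₂) g 2+n≤N₁ (ℕ.s≤s 1+n≤N₂) g≡0 = begin
    sumTo N₁ (λ i → sumTo (suc N₂) (g i))
      ≡⟨ sumTo-sumTo-peel N₁ N₂ g ⟩
    sumTo N₁ (λ i → g i 0) ℤ.+ sumTo N₁ (λ i → sumTo N₂ (λ j → g i (suc j)))
      ≡⟨ ≡.cong₂ ℤ._+_ (sumTo-single N₁ (suc (suc n)) (λ i → g i 0) 2+n≤N₁ (λ i i≢2+n → g≡0 i 0 (i+0≢n i≢2+n)))
                       (sumTo-sumTo-antidiagonal₂ n N₁ N₂ (λ i j → g i (suc j))
                          (ℕP.≤-trans (ℕP.n≤1+n n) (ℕP.<⇒≤ 2+n≤N₁)) (ℕP.<⇒≤ 1+n≤N₂)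
                          (λ i j i+2j≢n → g≡0 i (suc j)
                             (λ e → i+2j≢n (ℕP.suc-injective (ℕP.suc-injective (≡.trans (≡.sym (+-2*-suc i j)) e)))))) ⟩
    antidiagonal₂ ℤ._+_ (suc (suc n)) g ∎

-- The ring ℤ[[q]][[y]][[x]]

-- Series is definitionally its carrier: a series is the sequence of its x-coefficients, each a
-- series in y over ℤ[[q]].
module ℤ[[q]]     = PowerSeries ℤP.+-*-commutativeRing
module ℤ[[q,y]]   = PowerSeries ℤ[[q]].⊞-⊠-commutativeRing
module ℤ[[q,y,x]] = PowerSeries ℤ[[q,y]].⊞-⊠-commutativeRing

open CommutativeRing ℤ[[q,y,x]].⊞-⊠-commutativeRing hiding (zero)
open AntidiagonalSumsInRing ℤ[[q,y,x]].⊞-⊠-commutativeRing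

one-minus-cong : ∀ {u v} → u ≈ v → 1# - u ≈ 1# - v
one-minus-cong u≈v = +-congˡ {1#} (-‿cong u≈v)

coefficientwise : ∀ {f g : Series} → (∀ a b c → f a b c ≡ g a b c) → f ≈ g
coefficientwise f≡g =
  ℤ[[q,y,x]].coeffwise λ a → ℤ[[q,y]].coeffwise λ b → ℤ[[q]].coeffwise λ c → f≡g a b c

coefficient : ∀ {f g : Series} → f ≈ g → ∀ a b c → f a b c ≡ g a b c
coefficient f≈g a b c = ℤ[[q]].coeff (ℤ[[q,y]].coeff (ℤ[[q,y,x]].coeff f≈g a) b) c

lift : ℤ[[q]].PS → Series
lift r = ℤ[[q,y,x]].C (ℤ[[q,y]].C r)

lift-cong : ∀ {r s} → r ℤ[[q]].≋ s → lift r ≈ lift s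
lift-cong r≋s = ℤ[[q,y,x]].C-cong (ℤ[[q,y]].C-cong r≋s)

lift-+ : ∀ r s → lift (r ℤ[[q]].⊞ s) ≈ lift r + lift s
lift-+ r s = trans (ℤ[[q,y,x]].C-cong (ℤ[[q,y]].C-+ r s)) (ℤ[[q,y,x]].C-+ _ _)

lift-* : ∀ r s → lift (r ℤ[[q]].⊠ s) ≈ lift r * lift s
lift-* r s = trans (ℤ[[q,y,x]].C-cong (ℤ[[q,y]].C-* r s)) (ℤ[[q,y,x]].C-* _ _)

lift-neg : ∀ r → lift (ℤ[[q]].⊟ r) ≈ - lift r
lift-neg r = trans (ℤ[[q,y,x]].C-cong (ℤ[[q,y]].C-neg r)) (ℤ[[q,y,x]].C-neg _)

embed : ℤ → Series
embed k = lift (ℤ[[q]].C k)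

embed-homomorphism :
  CommutativeRing.rawRing ℤP.+-*-commutativeRing -Raw-AlmostCommutative⟶ fromCommutativeRing ℤ[[q,y,x]].⊞-⊠-commutativeRing
embed-homomorphism = record
  { ⟦_⟧    = embed
  ; +-homo = λ m n → trans (lift-cong (ℤ[[q]].C-+ m n)) (lift-+ _ _)
  ; *-homo = λ m n → trans (lift-cong (ℤ[[q]].C-* m n)) (lift-* _ _)
  ; -‿homo = λ m → trans (lift-cong (ℤ[[q]].C-neg m)) (lift-neg _)
  ; 0-homo = trans (lift-cong ℤ[[q]].C-0) (trans (ℤ[[q,y,x]].C-cong ℤ[[q,y]].C-0) ℤ[[q,y,x]].C-0)
  ; 1-homo = refl
  }

embed-≟ : ∀ m n → Maybe (embed m ≈ embed n)
embed-≟ m n = Maybe.map (λ { ≡.refl → refl }) (dec⇒weaklyDec ℤ._≟_ m n)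

open import Algebra.Solver.Ring (CommutativeRing.rawRing ℤP.+-*-commutativeRing)
  (fromCommutativeRing ℤ[[q,y,x]].⊞-⊠-commutativeRing) embed-homomorphism embed-≟

*-coefficient : ∀ f g a b c → (f * g) a b c ≡
  antidiagonal ℤ._+_ a λ i j → antidiagonal ℤ._+_ b λ k l → antidiagonal ℤ._+_ c λ r s → f i k r ℤ.* g j l s
*-coefficient f g a b c = begin
  (f * g) a b c
    ≡⟨ ≡.cong (λ h → h c) (antidiagonal-pointwise ℤ[[q]]._⊞_ a (λ i j → f i ℤ[[q,y]].⊠ g j) b) ⟩
  antidiagonal ℤ[[q]]._⊞_ a (λ i j → (f i ℤ[[q,y]].⊠ g j) b) c
    ≡⟨ antidiagonal-pointwise ℤ._+_ a (λ i j → (f i ℤ[[q,y]].⊠ g j) b) c ⟩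
  antidiagonal ℤ._+_ a (λ i j → (f i ℤ[[q,y]].⊠ g j) b c)
    ≡⟨ ℤ-Sums.∑-cong a (λ i j → antidiagonal-pointwise ℤ._+_ b (λ k l → f i k ℤ[[q]].⊠ g j l) c) ⟩
  antidiagonal ℤ._+_ a (λ i j → antidiagonal ℤ._+_ b λ k l → antidiagonal ℤ._+_ c λ r s → f i k r ℤ.* g j l s) ∎
  where open ≡.≡-Reasoning

⊗-≈ : ∀ f g → f ⊗ g ≈ f * g
⊗-≈ f g = coefficientwise λ a b c → begin
  (f ⊗ g) a b c
    ≡⟨ sumTo-cong a (λ i → sumTo-cong b (λ k → sumTo-antidiagonal c (λ r s → f i k r ℤ.* g (a ∸ i) (b ∸ k) s))) ⟩
  sumTo a (λ i → sumTo b λ k → antidiagonal ℤ._+_ c λ r s → f i k r ℤ.* g (a ∸ i) (b ∸ k) s)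
    ≡⟨ sumTo-cong a (λ i → sumTo-antidiagonal b (λ k l → antidiagonal ℤ._+_ c λ r s → f i k r ℤ.* g (a ∸ i) l s)) ⟩
  sumTo a (λ i → antidiagonal ℤ._+_ b λ k l → antidiagonal ℤ._+_ c λ r s → f i k r ℤ.* g (a ∸ i) l s)
    ≡⟨ sumTo-antidiagonal a (λ i j → antidiagonal ℤ._+_ b λ k l → antidiagonal ℤ._+_ c λ r s → f i k r ℤ.* g j l s) ⟩
  antidiagonal ℤ._+_ a (λ i j → antidiagonal ℤ._+_ b λ k l → antidiagonal ℤ._+_ c λ r s → f i k r ℤ.* g j l s)
    ≡⟨ *-coefficient f g a b c ⟨
  (f * g) a b c ∎
  where open ≡.≡-Reasoning

·-≈ : ∀ k f → k · f ≈ embed k * f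
·-≈ k f = coefficientwise λ a b c → ≡.sym (begin
  (embed k * f) a b c
    ≡⟨ ℤ[[q]].coeff (ℤ[[q,y]].coeff (ℤ[[q,y,x]].coeff (ℤ[[q,y,x]].C-⊠ (ℤ[[q,y]].C (ℤ[[q]].C k)) f) a) b) c ⟩
  (ℤ[[q,y]].C (ℤ[[q]].C k) ℤ[[q,y]].⊠ f a) b c
    ≡⟨ ℤ[[q]].coeff (ℤ[[q,y]].coeff (ℤ[[q,y]].C-⊠ (ℤ[[q]].C k) (f a)) b) c ⟩
  (ℤ[[q]].C k ℤ[[q]].⊠ f a b) c
    ≡⟨ ℤ[[q]].coeff (ℤ[[q]].C-⊠ k (f a b)) c ⟩
  k ℤ.* f a b c ∎)
  where open ≡.≡-Reasoning

mono-monomial : ∀ a b c → mono a b c ≈ ℤ[[q,y,x]].monomial a (ℤ[[q,y]].monomial b (ℤ[[q]].monomial c (+ 1)))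
mono-monomial a b c = coefficientwise go
  where
  go : ∀ a′ b′ c′ →
    mono a b c a′ b′ c′ ≡ ℤ[[q,y,x]].monomial a (ℤ[[q,y]].monomial b (ℤ[[q]].monomial c (+ 1))) a′ b′ c′
  go a′ b′ c′ with does (a ≟ a′)
  ... | false = ≡.refl
  ... | true with does (b ≟ b′)
  ...   | false = ≡.refl
  ...   | true  = ≡.refl

mono-* : ∀ a b c a′ b′ c′ → mono a b c * mono a′ b′ c′ ≈ mono (a ℕ.+ a′) (b ℕ.+ b′) (c ℕ.+ c′)
mono-* a b c a′ b′ c′ = begin
  mono a b c * mono a′ b′ c′
    ≈⟨ *-cong (mono-monomial a b c) (mono-monomial a′ b′ c′) ⟩
  monomial₃ a (monomial₂ b (monomial₁ c (+ 1))) * monomial₃ a′ (monomial₂ b′ (monomial₁ c′ (+ 1)))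
    ≈⟨ ℤ[[q,y,x]].monomial-⊠-monomial a a′ _ _ ⟩
  monomial₃ (a ℕ.+ a′) (monomial₂ b (monomial₁ c (+ 1)) ℤ[[q,y]].⊠ monomial₂ b′ (monomial₁ c′ (+ 1)))
    ≈⟨ ℤ[[q,y,x]].monomial-cong (a ℕ.+ a′)
         (ℤ[[q,y]].≋-trans (ℤ[[q,y]].monomial-⊠-monomial b b′ _ _)
                           (ℤ[[q,y]].monomial-cong (b ℕ.+ b′) (ℤ[[q]].monomial-⊠-monomial c c′ _ _))) ⟩
  monomial₃ (a ℕ.+ a′) (monomial₂ (b ℕ.+ b′) (monomial₁ (c ℕ.+ c′) (+ 1)))
    ≈⟨ mono-monomial (a ℕ.+ a′) (b ℕ.+ b′) (c ℕ.+ c′) ⟨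
  mono (a ℕ.+ a′) (b ℕ.+ b′) (c ℕ.+ c′) ∎
  where
  open import Relation.Binary.Reasoning.Setoid setoid
  monomial₁ = ℤ[[q]].monomial
  monomial₂ = ℤ[[q,y]].monomial
  monomial₃ = ℤ[[q,y,x]].monomial

1S-≈ : 1S ≈ 1#
1S-≈ = mono-monomial 0 0 0

invOneMinusQ^-lift : ∀ k → invOneMinusQ^ k ≈ lift (ℤ[[q]].geometric k)
invOneMinusQ^-lift k = coefficientwise λ
  { zero zero c    → ≡.refl
  ; zero (suc b) c → ≡.refl
  ; (suc a) b c    → ≡.refl }

invOneMinusQ^-inverse : ∀ k → invOneMinusQ^ (suc k) * (1# - mono 0 0 (suc k)) ≈ 1#
invOneMinusQ^-inverse k = begin
  invOneMinusQ^ (suc k) * (1# - mono 0 0 (suc k))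
    ≈⟨ *-cong (invOneMinusQ^-lift (suc k)) (one-minus-cong (mono-monomial 0 0 (suc k))) ⟩
  lift g * (lift (ℤ[[q]].C (+ 1)) - lift t^K)
    ≈⟨ *-congˡ {lift g} (+-congˡ {1#} (lift-neg t^K)) ⟨
  lift g * (lift (ℤ[[q]].C (+ 1)) + lift (ℤ[[q]].⊟ t^K))
    ≈⟨ *-congˡ {lift g} (lift-+ (ℤ[[q]].C (+ 1)) (ℤ[[q]].⊟ t^K)) ⟨
  lift g * lift (ℤ[[q]].C (+ 1) ℤ[[q]].⊞ ℤ[[q]].⊟ t^K)
    ≈⟨ lift-* g _ ⟨
  lift (g ℤ[[q]].⊠ (ℤ[[q]].C (+ 1) ℤ[[q]].⊞ ℤ[[q]].⊟ t^K))
    ≈⟨ lift-cong (ℤ[[q]].geometric-inverse k) ⟩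
  1# ∎
  where
  open import Relation.Binary.Reasoning.Setoid setoid
  g = ℤ[[q]].geometric (suc k)
  t^K = ℤ[[q]].monomial (suc k) (+ 1)

∑-coefficient : ∀ n T a b c → ∑ n T a b c ≡ antidiagonal ℤ._+_ n (λ i j → T i j a b c)
∑-coefficient n T a b c =
  ≡.trans (≡.cong (λ h → h b c) (antidiagonal-pointwise ℤ[[q,y]]._⊞_ n T a))
  (≡.trans (≡.cong (λ h → h c) (antidiagonal-pointwise ℤ[[q]]._⊞_ n (λ i j → T i j a) b))
           (antidiagonal-pointwise ℤ._+_ n (λ i j → T i j a b) c))

∑₂-coefficient : ∀ n T a b c → ∑₂ n T a b c ≡ antidiagonal₂ ℤ._+_ n (λ i j → T i j a b c)
∑₂-coefficient n T a b c =
  ≡.trans (≡.cong (λ h → h b c) (antidiagonal₂-pointwise ℤ[[q,y]]._⊞_ n T a))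
  (≡.trans (≡.cong (λ h → h c) (antidiagonal₂-pointwise ℤ[[q]]._⊞_ n (λ i j → T i j a) b))
           (antidiagonal₂-pointwise ℤ._+_ n (λ i j → T i j a b) c))

-- Homogeneity in y

YHomogeneous : ℕ → Series → Set
YHomogeneous m f = ∀ a b c → b ≢ m → f a b c ≡ + 0

yHomogeneous-≈ : ∀ {m f g} → f ≈ g → YHomogeneous m f → YHomogeneous m g
yHomogeneous-≈ f≈g f-hom a b c b≢m = ≡.trans (≡.sym (coefficient f≈g a b c)) (f-hom a b c b≢m)

yHomogeneous-+ : ∀ {m f g} → YHomogeneous m f → YHomogeneous m g → YHomogeneous m (f + g)
yHomogeneous-+ f-hom g-hom a b c b≢m = ≡.cong₂ ℤ._+_ (f-hom a b c b≢m) (g-hom a b c b≢m)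

yHomogeneous-neg : ∀ {m f} → YHomogeneous m f → YHomogeneous m (- f)
yHomogeneous-neg f-hom a b c b≢m = ≡.cong ℤ.-_ (f-hom a b c b≢m)

yHomogeneous-* : ∀ {m m′ f g} → YHomogeneous m f → YHomogeneous m′ g → YHomogeneous (m ℕ.+ m′) (f * g)
yHomogeneous-* {m} {m′} {f} {g} f-hom g-hom a b c b≢m+m′ = begin
  (f * g) a b c
    ≡⟨ *-coefficient f g a b c ⟩
  antidiagonal ℤ._+_ a (λ i j → antidiagonal ℤ._+_ b λ k l → antidiagonal ℤ._+_ c λ r s → f i k r ℤ.* g j l s)
    ≡⟨ ℤ-Sums.∑-cong a (λ i j → ℤ-Sums.∑-cong-on b (λ k l k+l≡b → ℤ-Sums.∑-cong c (λ r s → term k+l≡b))) ⟩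
  antidiagonal ℤ._+_ a (λ i j → antidiagonal ℤ._+_ b λ k l → antidiagonal ℤ._+_ c λ r s → + 0)
    ≡⟨ ℤ-Sums.∑-cong a (λ i j → ≡.trans (ℤ-Sums.∑-cong b (λ k l → ℤ-Sums.∑-ε c)) (ℤ-Sums.∑-ε b)) ⟩
  antidiagonal ℤ._+_ a (λ i j → + 0)
    ≡⟨ ℤ-Sums.∑-ε a ⟩
  + 0 ∎
  where
  open ≡.≡-Reasoning
  term : ∀ {i j k l r s} → k ℕ.+ l ≡ b → f i k r ℤ.* g j l s ≡ + 0
  term {i} {j} {k} {l} {r} {s} k+l≡b with k ≟ m | l ≟ m′
  ... | no k≢m     | _          = ≡.cong (ℤ._* g j l s) (f-hom i k r k≢m)
  ... | yes _      | no l≢m′    = ≡.trans (≡.cong (f i k r ℤ.*_) (g-hom j l s l≢m′)) (ℤP.*-zeroʳ (f i k r))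
  ... | yes ≡.refl | yes ≡.refl = ⊥-elim (b≢m+m′ (≡.sym k+l≡b))

yHomogeneous-⊗ : ∀ {m m′ f g} → YHomogeneous m f → YHomogeneous m′ g → YHomogeneous (m ℕ.+ m′) (f ⊗ g)
yHomogeneous-⊗ {f = f} {g} f-hom g-hom = yHomogeneous-≈ (sym (⊗-≈ f g)) (yHomogeneous-* f-hom g-hom)

yHomogeneous-mono : ∀ a b c → YHomogeneous b (mono a b c)
yHomogeneous-mono a b c a′ b′ c′ b′≢b with does (a ≟ a′)
... | false = ≡.refl
... | true rewrite dec-false (b ≟ b′) (λ b≡b′ → b′≢b (≡.sym b≡b′)) = ≡.refl

yHomogeneous-embed : ∀ k → YHomogeneous 0 (embed k)
yHomogeneous-embed k zero    zero    c 0≢0 = ⊥-elim (0≢0 ≡.refl)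
yHomogeneous-embed k zero    (suc b) c _   = ≡.refl
yHomogeneous-embed k (suc a) b       c _   = ≡.refl

yHomogeneous-invOneMinusQ^ : ∀ k → YHomogeneous 0 (invOneMinusQ^ k)
yHomogeneous-invOneMinusQ^ k zero    zero    c 0≢0 = ⊥-elim (0≢0 ≡.refl)
yHomogeneous-invOneMinusQ^ k zero    (suc b) c _   = ≡.refl
yHomogeneous-invOneMinusQ^ k (suc a) b       c _   = ≡.refl

yHomogeneous-invQPoch : ∀ k n → YHomogeneous 0 (invQPoch k n)
yHomogeneous-invQPoch k zero    = yHomogeneous-mono 0 0 0
yHomogeneous-invQPoch k (suc n) = yHomogeneous-⊗ (yHomogeneous-invQPoch k n) (yHomogeneous-invOneMinusQ^ _)

yHomogeneous-xQPoch2 : ∀ n → YHomogeneous 0 (xQPoch2 n)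
yHomogeneous-xQPoch2 zero    = yHomogeneous-mono 0 0 0
yHomogeneous-xQPoch2 (suc n) = yHomogeneous-⊗ (yHomogeneous-xQPoch2 n)
  (yHomogeneous-+ (yHomogeneous-mono 0 0 0) (yHomogeneous-neg (yHomogeneous-mono 1 0 (2 ℕ.* n))))

yHomogeneous-reindex : ∀ {m m′ f} → m ≡ m′ → YHomogeneous m f → YHomogeneous m′ f
yHomogeneous-reindex ≡.refl f-hom = f-hom

yHomogeneous-lhsTerm : ∀ i j → YHomogeneous (i ℕ.+ 2 ℕ.* j) (lhsTerm i j)
yHomogeneous-lhsTerm i j = yHomogeneous-reindex (≡.trans (ℕP.+-identityʳ _) (ℕP.+-identityʳ _))
  (yHomogeneous-⊗ (yHomogeneous-⊗ (yHomogeneous-mono i _ ((2 ℕ.* i ℕ.* i ∸ i) ℕ.+ 4 ℕ.* j ℕ.* j ℕ.+ 4 ℕ.* i ℕ.* j))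
                                  (yHomogeneous-invQPoch 2 i))
                  (yHomogeneous-invQPoch 4 j))

yHomogeneous-rhsTerm : ∀ i j → YHomogeneous (i ℕ.+ j) (rhsTerm i j)
yHomogeneous-rhsTerm i j = yHomogeneous-reindex (≡.trans (ℕP.+-identityʳ _) (ℕP.+-identityʳ _))
  (yHomogeneous-⊗ (yHomogeneous-⊗ (yHomogeneous-≈ (sym (·-≈ (neg1^ j) _))
                                    (yHomogeneous-* (yHomogeneous-embed (neg1^ j))
                                       (yHomogeneous-⊗ (yHomogeneous-xQPoch2 j)
                                          (yHomogeneous-mono 0 _ (i ℕ.* i ℕ.+ j ℕ.* j ℕ.+ 2 ℕ.* i ℕ.* j)))))
                                  (yHomogeneous-invQPoch 2 i))
                  (yHomogeneous-invQPoch 2 j))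

Σ∞²-∑ : ∀ T → (∀ i j → YHomogeneous (i ℕ.+ j) (T i j)) → ∀ a b c → Σ∞² T a b c ≡ ∑ b T a b c
Σ∞²-∑ T T-hom a b c = ≡.trans
  (sumTo-sumTo-antidiagonal b b b (λ i j → T i j a b c) ℕP.≤-refl ℕP.≤-refl
     (λ i j i+j≢b → T-hom i j a b c (λ b≡i+j → i+j≢b (≡.sym b≡i+j))))
  (≡.sym (∑-coefficient b T a b c))

Σ∞²-∑₂ : ∀ T → (∀ i j → YHomogeneous (i ℕ.+ 2 ℕ.* j) (T i j)) → ∀ a b c → Σ∞² T a b c ≡ ∑₂ b T a b c
Σ∞²-∑₂ T T-hom a b c = ≡.trans
  (sumTo-sumTo-antidiagonal₂ b b b (λ i j → T i j a b c) ℕP.≤-refl ℕP.≤-refl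
     (λ i j i+2j≢b → T-hom i j a b c (λ b≡i+2j → i+2j≢b (≡.sym b≡i+2j))))
  (≡.sym (∑₂-coefficient b T a b c))

-- The recurrence

module _ where
  open import Algebra.Properties.Semiring.Exp semiring using (_^_; ^-homo-*; ^-congʳ)
  open import Relation.Binary.Reasoning.Setoid setoid

  x p : Series
  x = mono 1 0 0
  p = mono 0 0 2

  p^-mono : ∀ n → p ^ n ≈ mono 0 0 (2 ℕ.* n)
  p^-mono zero    = sym 1S-≈
  p^-mono (suc n) = begin
    p * p ^ n                ≈⟨ *-congˡ {p} (p^-mono n) ⟩
    p * mono 0 0 (2 ℕ.* n)   ≈⟨ mono-* 0 0 2 0 0 (2 ℕ.* n) ⟩
    mono 0 0 (2 ℕ.+ 2 ℕ.* n) ≡⟨ ≡.cong (mono 0 0) (ℕP.*-suc 2 n) ⟨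
    mono 0 0 (2 ℕ.* suc n)   ∎

  invOneMinusQ^-cancels : ∀ k f → (1# - mono 0 0 (suc k)) * (f ⊗ invOneMinusQ^ (suc k)) ≈ f
  invOneMinusQ^-cancels k f = begin
    (1# - M) * (f ⊗ I)  ≈⟨ *-congˡ {1# - M} (⊗-≈ f I) ⟩
    (1# - M) * (f * I)  ≈⟨ solve 3 (λ f I M → (con (+ 1) :- M) :* (f :* I) := f :* (I :* (con (+ 1) :- M))) refl f I M ⟩
    f * (I * (1# - M))  ≈⟨ *-congˡ {f} (invOneMinusQ^-inverse k) ⟩
    f * 1#              ≈⟨ *-identityʳ f ⟩
    f                   ∎
    where
    I = invOneMinusQ^ (suc k)
    M = mono 0 0 (suc k)

  A B E a P : ℕ → Series
  A = invQPoch 2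
  B = invQPoch 4
  E i = mono i 0 (i ℕ.* i ∸ i)
  a i = E i * A i
  P j = embed (neg1^ j) * xQPoch2 j

  A-zero : A 0 ≈ 1#
  A-zero = 1S-≈

  A-suc : ∀ i → (1# - p ^ suc i) * A (suc i) ≈ A i
  A-suc i = trans (*-congʳ (one-minus-cong (p^-mono (suc i)))) (invOneMinusQ^-cancels _ (A i))

  B-zero : B 0 ≈ 1#
  B-zero = 1S-≈

  B-suc : ∀ j → (1# - p ^ (2 ℕ.* suc j)) * B (suc j) ≈ B j
  B-suc j = begin
    (1# - p ^ (2 ℕ.* suc j)) * B (suc j)             ≈⟨ *-congʳ (one-minus-cong (p^-mono (2 ℕ.* suc j))) ⟩
    (1# - mono 0 0 (2 ℕ.* (2 ℕ.* suc j))) * B (suc j) ≡⟨ ≡.cong (λ k → (1# - mono 0 0 k) * B (suc j)) (ℕP.*-assoc 2 2 (suc j)) ⟨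
    (1# - mono 0 0 (4 ℕ.* suc j)) * B (suc j)         ≈⟨ invOneMinusQ^-cancels _ (B j) ⟩
    B j                                              ∎

  E-zero : E 0 ≈ 1#
  E-zero = 1S-≈

  E-suc : ∀ i → E (suc i) ≈ x * p ^ i * E i
  E-suc i = begin
    mono (suc i) 0 (suc i ℕ.* suc i ∸ suc i)      ≡⟨ ≡.cong (mono (suc i) 0) (suc-square∸ i) ⟩
    mono (suc i) 0 (2 ℕ.* i ℕ.+ (i ℕ.* i ∸ i))    ≈⟨ mono-* 1 0 (2 ℕ.* i) i 0 (i ℕ.* i ∸ i) ⟨
    mono 1 0 (2 ℕ.* i) * E i                       ≈⟨ *-congʳ (mono-* 1 0 0 0 0 (2 ℕ.* i)) ⟨
    x * mono 0 0 (2 ℕ.* i) * E i                   ≈⟨ *-congʳ (*-congˡ {x} (p^-mono i)) ⟨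
    x * p ^ i * E i                                ∎

  1#*1#≈1# : 1# * 1# ≈ 1#
  1#*1#≈1# = *-identityʳ 1#

  a-zero : a 0 ≈ 1#
  a-zero = trans (*-cong E-zero A-zero) 1#*1#≈1#

  a-suc : ∀ i → (1# - p ^ suc i) * a (suc i) ≈ x * p ^ i * a i
  a-suc i = begin
    (1# - p ^ suc i) * (E (suc i) * A (suc i))
      ≈⟨ solve 3 (λ u e b → (con (+ 1) :- u) :* (e :* b) := e :* ((con (+ 1) :- u) :* b)) refl (p ^ suc i) (E (suc i)) (A (suc i)) ⟩
    E (suc i) * ((1# - p ^ suc i) * A (suc i))  ≈⟨ *-cong (E-suc i) (A-suc i) ⟩
    x * p ^ i * E i * A i                       ≈⟨ *-assoc (x * p ^ i) (E i) (A i) ⟩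
    x * p ^ i * a i                             ∎

  P-zero : P 0 ≈ 1#
  P-zero = trans (*-congˡ {1#} 1S-≈) 1#*1#≈1#

  P-suc : ∀ j → P (suc j) ≈ P j * (x * p ^ j - 1#)
  P-suc j = begin
    embed (ℤ.- neg1^ j) * (xQPoch2 j ⊗ (1S ⊖ mono 1 0 (2 ℕ.* j)))
      ≈⟨ *-cong (-‿homo (neg1^ j)) (⊗-≈ (xQPoch2 j) _) ⟩
    - s * (X * (1S - mono 1 0 (2 ℕ.* j)))
      ≈⟨ *-congˡ { - s} (*-congˡ {X} (+-cong 1S-≈ (-‿cong (sym (mono-* 1 0 0 0 0 (2 ℕ.* j)))))) ⟩
    - s * (X * (1# - x * mono 0 0 (2 ℕ.* j)))
      ≈⟨ *-congˡ { - s} (*-congˡ {X} (one-minus-cong (*-congˡ {x} (p^-mono j)))) ⟨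
    - s * (X * (1# - x * p ^ j))
      ≈⟨ solve 4 (λ s X x u → :- s :* (X :* (con (+ 1) :- x :* u)) := s :* X :* (x :* u :- con (+ 1))) refl s X x (p ^ j) ⟩
    s * X * (x * p ^ j - 1#) ∎
    where
    open _-Raw-AlmostCommutative⟶_ embed-homomorphism using (-‿homo)
    s = embed (neg1^ j)
    X = xQPoch2 j

  1-p^-cancel : ∀ n {u v} → (1# - p ^ suc n) * u ≈ (1# - p ^ suc n) * v → u ≈ v
  1-p^-cancel n {u} {v} eq =
    trans (sym (cancelˡ {I} {1# - p ^ suc n} inverse u)) (trans (*-congˡ {I} eq) (cancelˡ {I} {1# - p ^ suc n} inverse v))
    where
    open import Algebra.Properties.Monoid *-monoid using (cancelˡ)
    I = invOneMinusQ^ (2 ℕ.* suc n)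
    inverse : I * (1# - p ^ suc n) ≈ 1#
    inverse = trans (*-congˡ {I} (one-minus-cong (p^-mono (suc n)))) (invOneMinusQ^-inverse _)

  record IsSolution (H : ℕ → Series) : Set where
    field
      initial : H 0 ≈ 1#
      first   : (1# - p ^ 1) * H 1 ≈ x
      step    : ∀ n → (1# - p ^ suc (suc n)) * H (suc (suc n)) ≈ H n + x * p ^ suc n * H (suc n)

  solutions-unique : ∀ {H H′} → IsSolution H → IsSolution H′ → ∀ n → H n ≈ H′ n
  solutions-unique {H} {H′} H-sol H′-sol n = proj₁ (consecutive n)
    where
    module H  = IsSolution H-sol
    module H′ = IsSolution H′-sol
    consecutive : ∀ n → H n ≈ H′ n × H (suc n) ≈ H′ (suc n)
    consecutive zero    = trans H.initial (sym H′.initial) , 1-p^-cancel 0 (trans H.first (sym H′.first))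
    consecutive (suc n) with consecutive n
    ... | Hn≈H′n , Hsn≈H′sn = Hsn≈H′sn , 1-p^-cancel (suc n) (begin
      (1# - p ^ suc (suc n)) * H (suc (suc n))   ≈⟨ H.step n ⟩
      H n + x * p ^ suc n * H (suc n)            ≈⟨ +-cong Hn≈H′n (*-congˡ {x * p ^ suc n} Hsn≈H′sn) ⟩
      H′ n + x * p ^ suc n * H′ (suc n)          ≈⟨ H′.step n ⟨
      (1# - p ^ suc (suc n)) * H′ (suc (suc n))  ∎)

  1-p^0-annihilates : ∀ t → (1# - p ^ 0) * t ≈ 0#
  1-p^0-annihilates t = trans (*-congʳ (-‿inverseʳ 1#)) (zeroˡ t)

  F : ℕ → Series
  F n = ∑₂ n (λ i j → a i * B j)

  F-initial : F 0 ≈ 1#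
  F-initial = trans (*-cong a-zero B-zero) 1#*1#≈1#

  F-first : (1# - p ^ 1) * F 1 ≈ x
  F-first = begin
    (1# - p ^ 1) * (a 1 * B 0)    ≈⟨ *-assoc (1# - p ^ 1) (a 1) (B 0) ⟨
    (1# - p ^ 1) * a 1 * B 0      ≈⟨ *-cong (a-suc 0) B-zero ⟩
    x * 1# * a 0 * 1#             ≈⟨ *-congʳ (*-congˡ {x * 1#} a-zero) ⟩
    x * 1# * 1# * 1#              ≈⟨ solve 1 (λ x → x :* con (+ 1) :* con (+ 1) :* con (+ 1) := x) refl x ⟩
    x                             ∎

  F-term-split : ∀ i j → (1# - p ^ (i ℕ.+ 2 ℕ.* j)) * (a i * B j)
    ≈ a i * ((1# - p ^ (2 ℕ.* j)) * B j) + p ^ (2 ℕ.* j) * ((1# - p ^ i) * a i) * B j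
  F-term-split i j = trans (*-congʳ (one-minus-cong (^-homo-* p i (2 ℕ.* j))))
    (solve 4 (λ u v a b → (con (+ 1) :- u :* v) :* (a :* b) := a :* ((con (+ 1) :- v) :* b) :+ v :* ((con (+ 1) :- u) :* a) :* b)
      refl (p ^ i) (p ^ (2 ℕ.* j)) (a i) (B j))

  F-step : ∀ n → (1# - p ^ suc (suc n)) * F (suc (suc n)) ≈ F n + x * p ^ suc n * F (suc n)
  F-step n = begin
    (1# - p ^ m) * F m
      ≈⟨ ∑₂-distribˡ m (1# - p ^ m) (λ i j → a i * B j) ⟩
    ∑₂ m (λ i j → (1# - p ^ m) * (a i * B j))
      ≈⟨ ∑₂-cong-on m (λ i j i+2j≡m → trans (*-congʳ (one-minus-cong (^-congʳ p (≡.sym i+2j≡m))))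
                                               (F-term-split i j)) ⟩
    ∑₂ m (λ i j → lowerJ i j + lowerI i j)
      ≈⟨ ∑₂-distrib-∙ m lowerJ lowerI ⟩
    ∑₂ m lowerJ + ∑₂ m lowerI
      ≈⟨ +-cong lowerJ-sum lowerI-sum ⟩
    F n + x * p ^ suc n * F (suc n) ∎
    where
    m = suc (suc n)
    lowerJ lowerI : ℕ → ℕ → Series
    lowerJ i j = a i * ((1# - p ^ (2 ℕ.* j)) * B j)
    lowerI i j = p ^ (2 ℕ.* j) * ((1# - p ^ i) * a i) * B j

    lowerJ-sum : ∑₂ m lowerJ ≈ F n
    lowerJ-sum = begin
      lowerJ m 0 + ∑₂ n (λ i j → lowerJ i (suc j))  ≈⟨ +-congʳ (trans (*-congˡ {a m} (1-p^0-annihilates (B 0))) (zeroʳ (a m))) ⟩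
      0# + ∑₂ n (λ i j → lowerJ i (suc j))          ≈⟨ +-identityˡ _ ⟩
      ∑₂ n (λ i j → lowerJ i (suc j))               ≈⟨ ∑₂-cong n (λ i j → *-congˡ {a i} (B-suc j)) ⟩
      F n                                          ∎

    lowerI-zero : ∀ j → lowerI 0 j ≈ 0#
    lowerI-zero j = begin
      p ^ (2 ℕ.* j) * ((1# - p ^ 0) * a 0) * B j  ≈⟨ *-congʳ (*-congˡ {p ^ (2 ℕ.* j)} (1-p^0-annihilates (a 0))) ⟩
      p ^ (2 ℕ.* j) * 0# * B j                    ≈⟨ *-congʳ (zeroʳ (p ^ (2 ℕ.* j))) ⟩
      0# * B j                                    ≈⟨ zeroˡ (B j) ⟩
      0#                                          ∎

    lowerI-suc : ∀ i j → i ℕ.+ 2 ℕ.* j ≡ suc n → lowerI (suc i) j ≈ x * p ^ suc n * (a i * B j)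
    lowerI-suc i j i+2j≡n = begin
      p ^ (2 ℕ.* j) * ((1# - p ^ suc i) * a (suc i)) * B j  ≈⟨ *-congʳ (*-congˡ {p ^ (2 ℕ.* j)} (a-suc i)) ⟩
      p ^ (2 ℕ.* j) * (x * p ^ i * a i) * B j
        ≈⟨ solve 5 (λ v x u a b → v :* (x :* u :* a) :* b := x :* (u :* v) :* (a :* b)) refl (p ^ (2 ℕ.* j)) x (p ^ i) (a i) (B j) ⟩
      x * (p ^ i * p ^ (2 ℕ.* j)) * (a i * B j)            ≈⟨ *-congʳ (*-congˡ {x} (sym (^-homo-* p i (2 ℕ.* j)))) ⟩
      x * p ^ (i ℕ.+ 2 ℕ.* j) * (a i * B j)                ≡⟨ ≡.cong (λ k → x * p ^ k * (a i * B j)) i+2j≡n ⟩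
      x * p ^ suc n * (a i * B j)                          ∎

    lowerI-sum : ∑₂ m lowerI ≈ x * p ^ suc n * F (suc n)
    lowerI-sum = begin
      ∑₂ m lowerI                                        ≈⟨ ∑₂-suc (suc n) lowerI lowerI-zero ⟩
      ∑₂ (suc n) (λ i j → lowerI (suc i) j)              ≈⟨ ∑₂-cong-on (suc n) lowerI-suc ⟩
      ∑₂ (suc n) (λ i j → x * p ^ suc n * (a i * B j))   ≈⟨ ∑₂-distribˡ (suc n) (x * p ^ suc n) (λ i j → a i * B j) ⟨
      x * p ^ suc n * F (suc n)                          ∎

  F-isSolution : IsSolution F
  F-isSolution = record { initial = F-initial ; first = F-first ; step = F-step }

  R : ℕ → ℕ → Series
  R i j = P j * A i * A j

  G S : ℕ → Series
  G n = ∑ n R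
  S n = ∑ n (λ i j → p ^ i * R i j)

  G-initial : G 0 ≈ 1#
  G-initial = trans (*-cong (*-cong P-zero A-zero) A-zero) (trans (*-congʳ 1#*1#≈1#) 1#*1#≈1#)

  ∑-lowerI : ∀ m → ∑ (suc m) (λ i j → (1# - p ^ i) * R i j) ≈ G m
  ∑-lowerI m = begin
    (1# - p ^ 0) * R 0 (suc m) + ∑ m (λ i j → (1# - p ^ suc i) * R (suc i) j)
      ≈⟨ +-cong (1-p^0-annihilates (R 0 (suc m))) (∑-cong m lowerI-suc) ⟩
    0# + G m
      ≈⟨ +-identityˡ (G m) ⟩
    G m ∎
    where
    lowerI-suc : ∀ i j → (1# - p ^ suc i) * R (suc i) j ≈ R i j
    lowerI-suc i j = begin
      (1# - p ^ suc i) * (P j * A (suc i) * A j)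
        ≈⟨ solve 4 (λ u c a b → (con (+ 1) :- u) :* (c :* a :* b) := c :* ((con (+ 1) :- u) :* a) :* b)
                   refl (p ^ suc i) (P j) (A (suc i)) (A j) ⟩
      P j * ((1# - p ^ suc i) * A (suc i)) * A j
        ≈⟨ *-congʳ (*-congˡ {P j} (A-suc i)) ⟩
      R i j ∎

  G-split : ∀ m → G (suc m) ≈ G m + S (suc m)
  G-split m = begin
    ∑ (suc m) R
      ≈⟨ ∑-cong (suc m) (λ i j → solve 2 (λ u r → r := (con (+ 1) :- u) :* r :+ u :* r) refl (p ^ i) (R i j)) ⟩
    ∑ (suc m) (λ i j → (1# - p ^ i) * R i j + p ^ i * R i j)
      ≈⟨ ∑-distrib-∙ (suc m) (λ i j → (1# - p ^ i) * R i j) (λ i j → p ^ i * R i j) ⟩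
    ∑ (suc m) (λ i j → (1# - p ^ i) * R i j) + S (suc m)
      ≈⟨ +-congʳ (∑-lowerI m) ⟩
    G m + S (suc m) ∎

  G-term-split : ∀ i j → (1# - p ^ (i ℕ.+ j)) * R i j ≈ (1# - p ^ i) * R i j + p ^ i * ((1# - p ^ j) * R i j)
  G-term-split i j = trans (*-congʳ (one-minus-cong (^-homo-* p i j)))
    (solve 3 (λ u v r → (con (+ 1) :- u :* v) :* r := (con (+ 1) :- u) :* r :+ u :* ((con (+ 1) :- v) :* r)) refl (p ^ i) (p ^ j) (R i j))

  G-rec : ∀ m → (1# - p ^ suc m) * G (suc m) ≈ G m - S m + x * p ^ m * G m
  G-rec m = begin
    (1# - p ^ suc m) * G (suc m)
      ≈⟨ ∑-distribˡ (suc m) (1# - p ^ suc m) R ⟩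
    ∑ (suc m) (λ i j → (1# - p ^ suc m) * R i j)
      ≈⟨ ∑-cong-on (suc m) (λ i j i+j≡m → trans (*-congʳ (one-minus-cong (^-congʳ p (≡.sym i+j≡m))))
                                                 (G-term-split i j)) ⟩
    ∑ (suc m) (λ i j → (1# - p ^ i) * R i j + lowerJ i j)
      ≈⟨ ∑-distrib-∙ (suc m) (λ i j → (1# - p ^ i) * R i j) lowerJ ⟩
    ∑ (suc m) (λ i j → (1# - p ^ i) * R i j) + ∑ (suc m) lowerJ
      ≈⟨ +-cong (∑-lowerI m) lowerJ-sum ⟩
    G m + (x * p ^ m * G m + - S m)
      ≈⟨ solve 3 (λ g y s → g :+ (y :+ :- s) := g :- s :+ y) refl (G m) (x * p ^ m * G m) (S m) ⟩
    G m - S m + x * p ^ m * G m ∎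
    where
    lowerJ : ℕ → ℕ → Series
    lowerJ i j = p ^ i * ((1# - p ^ j) * R i j)

    lowerJ-suc : ∀ i j → i ℕ.+ j ≡ m → lowerJ i (suc j) ≈ x * p ^ m * R i j + - (p ^ i * R i j)
    lowerJ-suc i j i+j≡m = begin
      p ^ i * ((1# - p ^ suc j) * (P (suc j) * A i * A (suc j)))
        ≈⟨ *-congˡ {p ^ i} (*-congˡ {1# - p ^ suc j} (*-congʳ (*-congʳ (P-suc j)))) ⟩
      p ^ i * ((1# - p ^ suc j) * (P j * (x * p ^ j - 1#) * A i * A (suc j)))
        ≈⟨ solve 7 (λ u v c x w a b → u :* ((con (+ 1) :- v) :* (c :* (x :* w :- con (+ 1)) :* a :* b))
                                     := x :* (u :* w) :* (c :* a :* ((con (+ 1) :- v) :* b)) :+ :- (u :* (c :* a :* ((con (+ 1) :- v) :* b))))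
             refl (p ^ i) (p ^ suc j) (P j) x (p ^ j) (A i) (A (suc j)) ⟩
      x * (p ^ i * p ^ j) * (P j * A i * ((1# - p ^ suc j) * A (suc j))) + - (p ^ i * (P j * A i * ((1# - p ^ suc j) * A (suc j))))
        ≈⟨ +-cong (*-cong (*-congˡ {x} (sym (^-homo-* p i j))) (*-congˡ {P j * A i} (A-suc j)))
                  (-‿cong (*-congˡ {p ^ i} (*-congˡ {P j * A i} (A-suc j)))) ⟩
      x * p ^ (i ℕ.+ j) * R i j + - (p ^ i * R i j)
        ≡⟨ ≡.cong (λ k → x * p ^ k * R i j + - (p ^ i * R i j)) i+j≡m ⟩
      x * p ^ m * R i j + - (p ^ i * R i j) ∎

    lowerJ-sum : ∑ (suc m) lowerJ ≈ x * p ^ m * G m + - S m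
    lowerJ-sum = begin
      ∑ (suc m) lowerJ
        ≈⟨ ∑-snoc m lowerJ ⟩
      ∑ m (λ i j → lowerJ i (suc j)) + p ^ suc m * ((1# - p ^ 0) * R (suc m) 0)
        ≈⟨ +-cong (∑-cong-on m lowerJ-suc) (trans (*-congˡ {p ^ suc m} (1-p^0-annihilates (R (suc m) 0))) (zeroʳ (p ^ suc m))) ⟩
      ∑ m (λ i j → x * p ^ m * R i j + - (p ^ i * R i j)) + 0#
        ≈⟨ +-identityʳ _ ⟩
      ∑ m (λ i j → x * p ^ m * R i j + - (p ^ i * R i j))
        ≈⟨ ∑-distrib-∙ m (λ i j → x * p ^ m * R i j) (λ i j → - (p ^ i * R i j)) ⟩
      ∑ m (λ i j → x * p ^ m * R i j) + ∑ m (λ i j → - (p ^ i * R i j))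
        ≈⟨ +-cong (sym (∑-distribˡ m (x * p ^ m) R)) (sym (∑-neg m (λ i j → p ^ i * R i j))) ⟩
      x * p ^ m * G m + - S m ∎

  G-first : (1# - p ^ 1) * G 1 ≈ x
  G-first = begin
    (1# - p ^ 1) * G 1                 ≈⟨ G-rec 0 ⟩
    G 0 - 1# * G 0 + x * 1# * G 0      ≈⟨ solve 2 (λ g x → g :- con (+ 1) :* g :+ x :* con (+ 1) :* g := x :* g) refl (G 0) x ⟩
    x * G 0                            ≈⟨ *-congˡ {x} G-initial ⟩
    x * 1#                             ≈⟨ *-identityʳ x ⟩
    x                                  ∎

  G-step : ∀ n → (1# - p ^ suc (suc n)) * G (suc (suc n)) ≈ G n + x * p ^ suc n * G (suc n)
  G-step n = begin
    (1# - p ^ suc (suc n)) * G (suc (suc n))          ≈⟨ G-rec (suc n) ⟩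
    G (suc n) - S (suc n) + y * G (suc n)             ≈⟨ +-congʳ (+-congʳ (G-split n)) ⟩
    G n + S (suc n) - S (suc n) + y * G (suc n)
      ≈⟨ solve 4 (λ g s y h → g :+ s :- s :+ y :* h := g :+ y :* h) refl (G n) (S (suc n)) y (G (suc n)) ⟩
    G n + y * G (suc n)                               ∎
    where y = x * p ^ suc n

  G-isSolution : IsSolution G
  G-isSolution = record { initial = G-initial ; first = G-first ; step = G-step }

  F≈G : ∀ n → F n ≈ G n
  F≈G = solutions-unique F-isSolution G-isSolution

  yq-power : ℕ → Series
  yq-power n = mono 0 n (n ℕ.* n)

  lhsTerm-factor : ∀ i j → lhsTerm i j ≈ yq-power (i ℕ.+ 2 ℕ.* j) * (a i * B j)
  lhsTerm-factor i j = begin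
    mono i n e ⊗ A i ⊗ B j              ≈⟨ trans (⊗-≈ (mono i n e ⊗ A i) (B j)) (*-congʳ (⊗-≈ (mono i n e) (A i))) ⟩
    mono i n e * A i * B j              ≈⟨ *-congʳ (*-congʳ (sym (trans (mono-* 0 n (n ℕ.* n) i 0 (i ℕ.* i ∸ i)) exponents))) ⟩
    yq-power n * E i * A i * B j
      ≈⟨ solve 4 (λ m e a b → m :* e :* a :* b := m :* (e :* a :* b)) refl (yq-power n) (E i) (A i) (B j) ⟩
    yq-power n * (a i * B j)            ∎
    where
    n = i ℕ.+ 2 ℕ.* j
    e = (2 ℕ.* i ℕ.* i ∸ i) ℕ.+ 4 ℕ.* j ℕ.* j ℕ.+ 4 ℕ.* i ℕ.* j
    exponents : mono i (n ℕ.+ 0) (n ℕ.* n ℕ.+ (i ℕ.* i ∸ i)) ≈ mono i n e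
    exponents = reflexive (≡.cong₂ (mono i) (ℕP.+-identityʳ n) (lhs-exponent i j))

  rhsTerm-factor : ∀ i j → rhsTerm i j ≈ yq-power (i ℕ.+ j) * R i j
  rhsTerm-factor i j = begin
    neg1^ j · (xQPoch2 j ⊗ mono 0 n e) ⊗ A i ⊗ A j
      ≈⟨ trans (⊗-≈ (neg1^ j · X ⊗ A i) (A j)) (*-congʳ (trans (⊗-≈ (neg1^ j · X) (A i))
           (*-congʳ (trans (·-≈ (neg1^ j) X) (*-congˡ {s} (⊗-≈ (xQPoch2 j) (mono 0 n e))))))) ⟩
    s * (xQPoch2 j * mono 0 n e) * A i * A j
      ≈⟨ *-congʳ (*-congʳ (*-congˡ {s} (*-congˡ {xQPoch2 j} (reflexive (≡.cong (mono 0 n) (rhs-exponent i j)))))) ⟩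
    s * (xQPoch2 j * yq-power n) * A i * A j
      ≈⟨ solve 5 (λ s X m a b → s :* (X :* m) :* a :* b := m :* (s :* X :* a :* b)) refl s (xQPoch2 j) (yq-power n) (A i) (A j) ⟩
    yq-power n * R i j ∎
    where
    n = i ℕ.+ j
    e = i ℕ.* i ℕ.+ j ℕ.* j ℕ.+ 2 ℕ.* i ℕ.* j
    s = embed (neg1^ j)
    X = xQPoch2 j ⊗ mono 0 n e

  ∑₂-lhsTerm≈∑-rhsTerm : ∀ n → ∑₂ n lhsTerm ≈ ∑ n rhsTerm
  ∑₂-lhsTerm≈∑-rhsTerm n = begin
    ∑₂ n lhsTerm
      ≈⟨ ∑₂-cong-on n (λ i j i+2j≡n → trans (lhsTerm-factor i j) (*-congʳ (reflexive (≡.cong yq-power i+2j≡n)))) ⟩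
    ∑₂ n (λ i j → yq-power n * (a i * B j))  ≈⟨ ∑₂-distribˡ n (yq-power n) (λ i j → a i * B j) ⟨
    yq-power n * F n                         ≈⟨ *-congˡ {yq-power n} (F≈G n) ⟩
    yq-power n * G n                         ≈⟨ ∑-distribˡ n (yq-power n) R ⟩
    ∑ n (λ i j → yq-power n * R i j)
      ≈⟨ ∑-cong-on n (λ i j i+j≡n → sym (trans (rhsTerm-factor i j) (*-congʳ (reflexive (≡.cong yq-power i+j≡n))))) ⟩
    ∑ n rhsTerm                              ∎

theorem2p2 : (a b c : ℕ) → Σ∞² lhsTerm a b c ≡ Σ∞² rhsTerm a b c
theorem2p2 a b c = begin
  Σ∞² lhsTerm a b c   ≡⟨ Σ∞²-∑₂ lhsTerm yHomogeneous-lhsTerm a b c ⟩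
  ∑₂ b lhsTerm a b c  ≡⟨ coefficient (∑₂-lhsTerm≈∑-rhsTerm b) a b c ⟩
  ∑ b rhsTerm a b c   ≡⟨ Σ∞²-∑ rhsTerm yHomogeneous-rhsTerm a b c ⟨
  Σ∞² rhsTerm a b c   ∎
  where open ≡.≡-Reasoning
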